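{- Let $\vec\alpha\,F$ be an $n$-ary BNF and fix $i$. If $\mathrm{set}_{F,i}\,x$ is finite for all $x$, then for every equivalence relation $\sim$ on $\vec\alpha\,F$ satisfying $x\sim y\Rightarrow\mathrm{map}_F\,\vec f\,x\sim\mathrm{map}_F\,\vec f\,y$ (for all $\vec f$), and every family $\mathcal A_i$ of subsets of $\alpha_i$ with $\mathcal A_i\neq\emptyset$ and $\bigcap\mathcal A_i\neq\emptyset$, $$\bigcap_{A\in\mathcal A_i}[\{x\mid\mathrm{set}_{F,i}\,x\subseteq A\}]_\sim\subseteq\Big[\{x\mid\mathrm{set}_{F,i}\,x\subseteq\textstyle\bigcap\mathcal A_i\}\Big]_\sim.$$
   Context: An $n$-ary BNF is a type constructor $\vec\alpha\,F$ (vector notation $\vec x=x_1,\dots,x_n$) with polymorphic mapper $\mathrm{map}_F::(\alpha_1\to\beta_1)\to\cdots\to(\alpha_n\to\beta_n)\to\vec\alpha\,F\to\vec\beta\,F$, setters $\mathrm{set}_{F,i}::\vec\alpha\,F\to\alpha_i\ \mathrm{set}$, infinite cardinal bound $\mathrm{bd}_F$, relator $\mathrm{rel}_F$, satisfying: $\mathrm{map}_F\,\vec{\mathrm{id}}=\mathrm{id}$; $\mathrm{map}_F\,\vec g\circ\mathrm{map}_F\,\vec f=\mathrm{map}_F\,\overrightarrow{(g\circ f)}$; $\mathrm{set}_{F,i}(\mathrm{map}_F\,\vec f\,x)=f_i\langle\mathrm{set}_{F,i}\,x\rangle$ (image); if $f_i z=g_i z$ for all $i$ and $z\in\mathrm{set}_{F,i}\,x$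 then $\mathrm{map}_F\,\vec f\,x=\mathrm{map}_F\,\vec g\,x$; $|\mathrm{set}_{F,i}\,x|\le\mathrm{bd}_F$; $(x,y)\in\mathrm{rel}_F\,\vec R$ iff some $z$ has $\mathrm{set}_{F,i}\,z\subseteq R_i$ for all $i$, $\mathrm{map}_F\,\overrightarrow{\mathrm{fst}}\,z=x$, $\mathrm{map}_F\,\overrightarrow{\mathrm{snd}}\,z=y$; $\mathrm{rel}_F\,\vec R\bullet\mathrm{rel}_F\,\vec S\subseteq\mathrm{rel}_F\,\overrightarrow{(R\bullet S)}$. Notation: $[x]_\sim=\{y\mid x\sim y\}$, $[A]_\sim=\{[x]_\sim\mid x\in A\}$. -}

module Defs where

open import Level using (Level; 0ℓ; _⊔_) renaming (suc to lsuc)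
open import Relation.Unary using (Pred)
open import Data.Nat using (ℕ)
open import Data.Fin using (Fin)
open import Data.Product using (Σ; ∃; _×_; _,_; proj₁; proj₂)
open import Data.List using (List)
open import Data.List.Membership.Propositional using (_∈_)
open import Function using (id; _∘_)
open import Function.Bundles using (_⇔_)
open import Relation.Binary.PropositionalEquality using (_≡_)
open import Relation.Binary.Structures using (IsEquivalence)

Subset : Set → Set₁
Subset A = A → Set

_⊆ˢ_ : {A : Set} {ℓ₁ ℓ₂ : Level} → Pred A ℓ₁ → Pred A ℓ₂ → Set (ℓ₁ ⊔ ℓ₂)
S ⊆ˢ T = ∀ a → S a → T a

_≐ˢ_ : {A : Set} → Subset A → Subset A → Set
S ≐ˢ T = ∀ a → S a ⇔ T a

FiniteSet : {A : Set} → Subset A → Set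
FiniteSet {A} S = Σ (List A) λ l → ∀ a → S a ⇔ (a ∈ l)

CardLe : {A : Set} → Subset A → Set → Set
CardLe {A} S B = Σ (A → B) λ g → ∀ a b → S a → S b → g a ≡ g b → a ≡ b

_•_ : {A B C : Set} → (A → B → Set) → (B → C → Set) → (A → C → Set)
(R • S) a c = ∃ λ b → R a b × S b c

record BNF (n : ℕ) : Set₁ where
  field
    F   : (Fin n → Set) → Set
    map : {A B : Fin n → Set} → ((j : Fin n) → A j → B j) → F A → F B
    set : {A : Fin n → Set} → (j : Fin n) → F A → Subset (A j)
    Bd  : Set    -- the (carrier of the) cardinal bound bd_F
    rel : {A B : Fin n → Set} → ((j : Fin n) → A j → B j → Set) → F A → F B → Set

    map-id   : {A : Fin n → Set} (x : F A) → map (λ _ → id) x ≡ x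
    map-comp : {A B C : Fin n → Set} (f : (j : Fin n) → A j → B j)
               (g : (j : Fin n) → B j → C j) (x : F A) →
               map g (map f x) ≡ map (λ j → g j ∘ f j) x
    set-map  : {A B : Fin n → Set} (f : (j : Fin n) → A j → B j) (x : F A)
               (j : Fin n) (b : B j) →
               set j (map f x) b ⇔ (∃ λ a → set j x a × f j a ≡ b)
    map-cong : {A B : Fin n → Set} (f g : (j : Fin n) → A j → B j) (x : F A) →
               (∀ j z → set j x z → f j z ≡ g j z) → map f x ≡ map g x
    bd-infinite : Σ (ℕ → Bd) λ g → ∀ a b → g a ≡ g b → a ≡ b
    set-bd   : {A : Fin n → Set} (x : F A) (j : Fin n) → CardLe (set j x) Bd
    in-rel   : {A B : Fin n → Set} (R : (j : Fin n) → A j → B j → Set)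
               (x : F A) (y : F B) →
               rel R x y ⇔
               (∃ λ (z : F (λ j → A j × B j)) →
                  (∀ j p → set j z p → R j (proj₁ p) (proj₂ p))
                  × map (λ _ → proj₁) z ≡ x × map (λ _ → proj₂) z ≡ y)
    rel-comp : {A B C : Fin n → Set} (R : (j : Fin n) → A j → B j → Set)
               (S : (j : Fin n) → B j → C j → Set) (x : F A) (z : F C) →
               (rel R • rel S) x z → rel (λ j → R j • S j) x z

[_]⟨_⟩ : {X : Set} → X → (X → X → Set) → Subset X
[ x ]⟨ _∼_ ⟩ = λ y → x ∼ y

-- [S]_∼ = {[x]_∼ | x ∈ S} : a set of classes;
-- C ∈ [S]_∼ iff C = [x]_∼ for some x ∈ S (equality of sets read extensionally)
[_]ˢ⟨_⟩ : {X : Set} {ℓ : Level} → Pred X ℓ → (X → X → Set) → Pred (Subset X) ℓ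
[ S ]ˢ⟨ _∼_ ⟩ C = ∃ λ x → S x × (C ≐ˢ [ x ]⟨ _∼_ ⟩)

⋂ : {A : Set} → Pred (Subset A) (lsuc 0ℓ) → Pred A (lsuc 0ℓ)
⋂ 𝒜 a = ∀ S → 𝒜 S → S a

{-# OPTIONS --safe #-}
-- Pick a representative x of C with set_i x finite. For an atom a ∈ set_i x
-- outside ⋂ 𝒜 choose S ∈ 𝒜 with a ∉ S and a representative y of C with
-- set_i y ⊆ S. The map r sending a to a chosen a₀ ∈ ⋂ 𝒜 (and everything
-- else to itself) fixes y, so x ∼ y = map r y ∼ map r x: the representative
-- map r x of C has lost the atom a. Finitely many such steps leave a
-- representative whose atoms all lie in ⋂ 𝒜.
module Submission where

open import Defs
open import Level using (Level; 0ℓ) renaming (suc to lsuc)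
open import Data.Nat using (ℕ)
open import Data.Fin using (Fin)
open import Data.Fin.Properties using (_≟_)
open import Data.Product using (∃; _×_; _,_)
open import Data.Sum using (_⊎_; inj₁; inj₂; [_,_]′)
open import Data.List using (List; []; _∷_)
open import Data.List.Membership.Propositional using (_∈_)
open import Data.List.Relation.Unary.Any using (here; there)
open import Data.Empty using (⊥-elim)
open import Relation.Nullary using (¬_; yes; no)
open import Relation.Unary using (Pred)
open import Relation.Binary.Definitions using (DecidableEquality)
open import Relation.Binary.Structures using (IsEquivalence)
open import Relation.Binary.PropositionalEquality using (_≡_; refl; sym; trans; subst)
open import Function using (id)
open import Function.Bundles using (Equivalence; mk⇔)
open import Axiom.ExcludedMiddle using (ExcludedMiddle)
open import Axiom.DoubleNegationElimination using (em⇒dne)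

open Equivalence using (to; from)

redirect : {X : Set} → DecidableEquality X → X → X → X → X
redirect _≟ˣ_ a b z with z ≟ˣ a
... | yes _ = b
... | no _ = z

module _ {X : Set} (_≟ˣ_ : DecidableEquality X) (a b : X) where

  redirect-≢ : ∀ z → ¬ z ≡ a → redirect _≟ˣ_ a b z ≡ z
  redirect-≢ z z≢a with z ≟ˣ a
  ... | yes z≡a = ⊥-elim (z≢a z≡a)
  ... | no _ = refl

  redirect-cases : ∀ z → redirect _≟ˣ_ a b z ≡ b ⊎ (¬ z ≡ a × redirect _≟ˣ_ a b z ≡ z)
  redirect-cases z with z ≟ˣ a
  ... | yes _ = inj₁ refl
  ... | no z≢a = inj₂ (z≢a , refl)

atIndex : {n : ℕ} {A : Fin n → Set} (i : Fin n) → (A i → A i) → (j : Fin n) → A j → A j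
atIndex i g j z with j ≟ i
... | yes refl = g z
... | no _ = z

atIndex-≡ : {n : ℕ} {A : Fin n → Set} (i : Fin n) (g : A i → A i) (z : A i) →
            atIndex {A = A} i g i z ≡ g z
atIndex-≡ i g z with i ≟ i
... | yes refl = refl
... | no i≢i = ⊥-elim (i≢i refl)

module _ {n : ℕ} (B : BNF n) where
  open BNF B

  map-fixes : {A : Fin n → Set} (f : (j : Fin n) → A j → A j) (x : F A) →
              (∀ j z → set j x z → f j z ≡ z) → map f x ≡ x
  map-fixes f x fixes = trans (map-cong f (λ _ z → z) x fixes) (map-id x)

  map-atIndex-fixes : {A : Fin n → Set} (i : Fin n) (g : A i → A i) (x : F A) →
                      (∀ z → set i x z → g z ≡ z) → map (atIndex {A = A} i g) x ≡ x
  map-atIndex-fixes {A} i g x fixes = map-fixes (atIndex {A = A} i g) x fixes′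
    where
    fixes′ : ∀ j z → set j x z → atIndex {A = A} i g j z ≡ z
    fixes′ j z z∈ with j ≟ i
    ... | yes refl = fixes z z∈
    ... | no _ = refl

  set-map-atIndex : {A : Fin n → Set} (i : Fin n) (g : A i → A i) (x : F A) (b : A i) →
                    set i (map (atIndex {A = A} i g) x) b → ∃ λ z → set i x z × g z ≡ b
  set-map-atIndex {A} i g x b b∈ with to (set-map (atIndex {A = A} i g) x i b) b∈
  ... | z , z∈ , e = z , z∈ , trans (sym (atIndex-≡ {A = A} i g z)) e

module _ {X : Set} {_∼_ : X → X → Set} (eqv : IsEquivalence _∼_) {C : Subset X} where
  open IsEquivalence eqv renaming (refl to ∼-refl; sym to ∼-sym; trans to ∼-trans)

  class-related : ∀ {x y} → C ≐ˢ [ x ]⟨ _∼_ ⟩ → C ≐ˢ [ y ]⟨ _∼_ ⟩ → x ∼ y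
  class-related C≐[x] C≐[y] = to (C≐[x] _) (from (C≐[y] _) ∼-refl)

  class-transfer : ∀ {x y} → x ∼ y → C ≐ˢ [ x ]⟨ _∼_ ⟩ → C ≐ˢ [ y ]⟨ _∼_ ⟩
  class-transfer x∼y C≐[x] z = mk⇔ (λ Cz → ∼-trans (∼-sym x∼y) (to (C≐[x] z) Cz))
                                   (λ y∼z → from (C≐[x] z) (∼-trans x∼y y∼z))

∈-∷-weaken : {X : Set} {ℓ : Level} {P : Pred X ℓ} {a z : X} {l : List X} →
             (z ≡ a → P z) → z ∈ a ∷ l ⊎ P z → z ∈ l ⊎ P z
∈-∷-weaken z≡a⇒Pz (inj₁ (here z≡a)) = inj₂ (z≡a⇒Pz z≡a)
∈-∷-weaken _ (inj₁ (there z∈l)) = inj₁ z∈l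
∈-∷-weaken _ (inj₂ Pz) = inj₂ Pz

module Minimisation (em : (ℓ : Level) → ExcludedMiddle ℓ)
    {n : ℕ} (B : BNF n) (i : Fin n)
    (_∼_ : {A : Fin n → Set} → BNF.F B A → BNF.F B A → Set)
    (eqv : {A : Fin n → Set} → IsEquivalence (_∼_ {A}))
    (map-resp : {A C : Fin n → Set} (f : (j : Fin n) → A j → C j) (x y : BNF.F B A) →
      x ∼ y → BNF.map B f x ∼ BNF.map B f y)
    {A : Fin n → Set} (𝒜 : Pred (Subset (A i)) (lsuc 0ℓ))
    (a₀ : A i) (a₀∈⋂𝒜 : ⋂ 𝒜 a₀)
    (C : Subset (BNF.F B A))
    (C-class : ∀ S → 𝒜 S → [ (λ x → BNF.set B i x ⊆ˢ S) ]ˢ⟨ _∼_ ⟩ C) where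

  open BNF B

  _≟ᵃ_ : DecidableEquality (A i)
  _ ≟ᵃ _ = em 0ℓ

  discard : A i → (j : Fin n) → A j → A j
  discard a = atIndex {A = A} i (redirect _≟ᵃ_ a a₀)

  outside-some-member : ∀ a → ¬ ⋂ 𝒜 a → ∃ λ S → 𝒜 S × ¬ S a
  outside-some-member a a∉⋂𝒜 =
    em⇒dne (em _) λ ∄S → a∉⋂𝒜 λ S S∈𝒜 → em⇒dne (em _) λ a∉S → ∄S (S , S∈𝒜 , a∉S)

  discard-representative : ∀ {x} a S → 𝒜 S → ¬ S a →
                           C ≐ˢ [ x ]⟨ _∼_ ⟩ → C ≐ˢ [ map (discard a) x ]⟨ _∼_ ⟩
  discard-representative {x} a S S∈𝒜 a∉S C≐[x] with C-class S S∈𝒜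
  ... | y , set-y⊆S , C≐[y] = class-transfer eqv x∼discard-x C≐[x]
    where
    open IsEquivalence eqv renaming (trans to ∼-trans)
    discard-fixes-y : map (discard a) y ≡ y
    discard-fixes-y = map-atIndex-fixes B i (redirect _≟ᵃ_ a a₀) y λ z z∈ →
      redirect-≢ _≟ᵃ_ a a₀ z λ z≡a → a∉S (subst S z≡a (set-y⊆S z z∈))
    x∼discard-x : x ∼ map (discard a) x
    x∼discard-x = ∼-trans (class-related eqv C≐[x] C≐[y])
      (subst (_∼ map (discard a) x) discard-fixes-y
        (map-resp (discard a) y x (class-related eqv C≐[y] C≐[x])))

  discard-atoms : ∀ {x a} (l : List (A i)) →
                  set i x ⊆ˢ (λ z → z ∈ a ∷ l ⊎ ⋂ 𝒜 z) →
                  set i (map (discard a) x) ⊆ˢ (λ z → z ∈ l ⊎ ⋂ 𝒜 z)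
  discard-atoms {x} {a} l set-x⊆ b b∈ with set-map-atIndex B i (redirect _≟ᵃ_ a a₀) x b b∈
  ... | z , z∈ , e with redirect-cases _≟ᵃ_ a a₀ z
  ...   | inj₁ z↦a₀ = inj₂ (subst (⋂ 𝒜) (trans (sym z↦a₀) e) a₀∈⋂𝒜)
  ...   | inj₂ (z≢a , z↦z) = subst (λ w → w ∈ l ⊎ ⋂ 𝒜 w) (trans (sym z↦z) e)
                                   (∈-∷-weaken {P = ⋂ 𝒜} (λ z≡a → ⊥-elim (z≢a z≡a)) (set-x⊆ z z∈))

  minimise : (l : List (A i)) (x : F A) → C ≐ˢ [ x ]⟨ _∼_ ⟩ →
             set i x ⊆ˢ (λ z → z ∈ l ⊎ ⋂ 𝒜 z) →
             [ (λ x → set i x ⊆ˢ ⋂ 𝒜) ]ˢ⟨ _∼_ ⟩ C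
  minimise [] x C≐[x] set-x⊆ = x , (λ z z∈ → [ (λ ()) , id ]′ (set-x⊆ z z∈)) , C≐[x]
  minimise (a ∷ l) x C≐[x] set-x⊆ with em _ {⋂ 𝒜 a}
  ... | yes a∈⋂𝒜 =
    minimise l x C≐[x] λ z z∈ →
      ∈-∷-weaken {P = ⋂ 𝒜} (λ z≡a → subst (⋂ 𝒜) (sym z≡a) a∈⋂𝒜) (set-x⊆ z z∈)
  ... | no a∉⋂𝒜 with outside-some-member a a∉⋂𝒜
  ...   | S , S∈𝒜 , a∉S =
    minimise l (map (discard a) x) (discard-representative a S S∈𝒜 a∉S C≐[x]) (discard-atoms l set-x⊆)

lemma3p11 : ((ℓ : Level) → ExcludedMiddle ℓ) →
    {n : ℕ} (B : BNF n) (i : Fin n) →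
    ({A : Fin n → Set} (x : BNF.F B A) → FiniteSet (BNF.set B i x)) →
    (_∼_ : {A : Fin n → Set} → BNF.F B A → BNF.F B A → Set) →
    ({A : Fin n → Set} → IsEquivalence (_∼_ {A})) →
    ({A C : Fin n → Set} (f : (j : Fin n) → A j → C j) (x y : BNF.F B A) →
      x ∼ y → BNF.map B f x ∼ BNF.map B f y) →
    {A : Fin n → Set} (𝒜 : Pred (Subset (A i)) (lsuc 0ℓ)) →
    (∃ λ S → 𝒜 S) →
    (∃ λ a → ⋂ 𝒜 a) →
    (C : Subset (BNF.F B A)) →
    (∀ S → 𝒜 S → [ (λ x → BNF.set B i x ⊆ˢ S) ]ˢ⟨ _∼_ ⟩ C) →
    [ (λ x → BNF.set B i x ⊆ˢ ⋂ 𝒜) ]ˢ⟨ _∼_ ⟩ C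
lemma3p11 em B i finite _∼_ eqv map-resp 𝒜 (S , S∈𝒜) (a₀ , a₀∈⋂𝒜) C C-class
  with C-class S S∈𝒜
... | x , _ , C≐[x] with finite x
...   | atoms , atoms-enumerate =
  Minimisation.minimise em B i _∼_ eqv map-resp 𝒜 a₀ a₀∈⋂𝒜 C C-class
    atoms x C≐[x] (λ z z∈ → inj₁ (to (atoms-enumerate z) z∈))
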